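{- Let $d\ge1$, $t\ge1$, and let $D$ be a $t$-solvable distribution on the hypercube $Q^d$. Define a distribution $D'$ on $Q^{d+1}$ by $D'(\mathbf{v}\cdot0)=D_{D(\mathbf{v})}(x_0)$ and $D'(\mathbf{v}\cdot1)=D_{D(\mathbf{v})}(x_1)$ for each $\mathbf{v}\in V(Q^d)$. Then $D'$ is $t$-solvable on $Q^{d+1}$, $|D'|\le \frac43|D|+\frac23|\sigma(D)|$, and $|\sigma(D')|\le 2|\sigma(D)|$.
   Context: A distribution on a graph $G=(V,E)$ is a function $D:V\to\mathbb{N}$, with size $|D|=\sum_v D(v)$; its support is $\sigma(D)=\{v\in V: D(v)>0\}$. A pebbling move removes two pebbles from a vertex having at least two pebbles and places one pebble on a neighbor. A distribution $D$ is $t$-solvable if for every vertex $v$, some sequence of pebbling moves starting from $D$ results in a distribution with at least $t$ pebbles on $v$. The hypercube $Q^d$ has vertex set $\{0,1\}^d$ (bitstrings of length $d$), two bitstrings adjacent iff they differ in exactly one bit; $\mathbf{v}\cdot b$ is the concatenation of the bitstring $\mathbf{v}$ with the bit $b$. With $K_2$ having vertices $x_0,x_1$, for integers $k\ge0$ the distributions $D_r$ on $K_2$ are: $D_{3k}(x_0)=D_{3k}(x_1)=2k$; $D_{3k+1}(x_0)=2k+2$, $D_{3k+1}(x_1)=2k$; $D_{3k+2}(x_0)=2k+2$, $D_{3k+2}(x_1)=2k+1$ (so $D_0$ is the empty distribution). -}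

module Defs where

open import Data.Nat using (ℕ; zero; suc; _+_; _≤_; _≤?_)
open import Data.Bool using (Bool; true; false)
open import Data.Fin using (Fin)
open import Data.Vec using (Vec; []; _∷_; lookup; init; last)
open import Data.List using (List; map; length; filter; _++_) renaming ([] to []ˡ; _∷_ to _∷ˡ_)
open import Data.Nat.ListAction using (sum)
open import Data.Product using (Σ; ∃; ∃-syntax; _×_)
open import Relation.Binary.PropositionalEquality using (_≡_; _≢_)
open import Relation.Binary.Construct.Closure.ReflexiveTransitive using (Star)

Vertex : ℕ → Set
Vertex d = Vec Bool d

Adjacent : ∀ {d} → Vertex d → Vertex d → Set
Adjacent {d} u v =
  Σ (Fin d) λ i → (lookup u i ≢ lookup v i) × (∀ j → j ≢ i → lookup u j ≡ lookup v j)

Dist : ℕ → Set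
Dist d = Vertex d → ℕ

allVertices : (d : ℕ) → List (Vertex d)
allVertices zero = [] ∷ˡ []ˡ
allVertices (suc d) = map (false ∷_) (allVertices d) ++ map (true ∷_) (allVertices d)

size : ∀ {d} → Dist d → ℕ
size {d} D = sum (map D (allVertices d))

suppSize : ∀ {d} → Dist d → ℕ
suppSize {d} D = length (filter (λ v → 1 ≤? D v) (allVertices d))

Move : ∀ {d} → Dist d → Dist d → Set
Move {d} D D' =
  Σ (Vertex d) λ u → Σ (Vertex d) λ v →
    Adjacent u v × 2 ≤ D u × D' u + 2 ≡ D u × D' v ≡ suc (D v)
    × (∀ w → w ≢ u → w ≢ v → D' w ≡ D w)

Reach : ∀ {d} → Dist d → Dist d → Set
Reach = Star Move

Solvable : ∀ {d} → ℕ → Dist d → Set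
Solvable {d} t D = ∀ (v : Vertex d) → ∃[ D' ] (Reach D D' × t ≤ D' v)

-- The distributions D_r on K_2 = {x_0, x_1}; x_0 ↔ false, x_1 ↔ true.
-- Defined by recursion using D_{r+3} = D_r + 2 on each vertex, which agrees
-- with the paper's: D_{3k} = (2k,2k), D_{3k+1} = (2k+2,2k), D_{3k+2} = (2k+2,2k+1).
DK : ℕ → Bool → ℕ
DK zero b = 0
DK (suc zero) false = 2
DK (suc zero) true = 0
DK (suc (suc zero)) false = 2
DK (suc (suc zero)) true = 1
DK (suc (suc (suc r))) b = 2 + DK r b

-- D' on Q^{d+1}: D'(v·b) = D_{D(v)}(x_b), where v·b appends bit b at the end.
lift : ∀ {d} → Dist d → Dist (suc d)
lift D w = DK (D (init w)) (last w)

-- Q^{d+1} is Q^d × K₂, with fibres {v·0, v·1}.  On a fibre carrying D_r, either vertex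
-- v·b can collect r pebbles, since D_r(x_b) + ⌊D_r(x_{1-b})/2⌋ ≥ r.  This inequality is an
-- invariant that survives simulating a pebbling move u → w of Q^d inside the layer b
-- (first pull the fibre of u onto u·b, then move u·b → w·b), so whatever D can put on v,
-- D' can put on v·b.  The size and support bounds are fibrewise inequalities for D_r
-- summed over Q^d.
module Submission where

open import Defs
open import Data.Nat using (ℕ; zero; suc; _+_; _*_; _≤_; _∸_; z≤n; s≤s; _≤?_; ⌊_/2⌋)
open import Data.Nat.Properties
open import Data.Nat.Tactic.RingSolver using (solve-∀)
open import Data.Nat.ListAction using (sum)
open import Data.Nat.ListAction.Properties using (sum-++)
open import Data.Bool using (Bool; true; false; not)
open import Data.Bool.Properties using () renaming (_≟_ to _≟ᵇ_)
open import Data.Unit using (tt)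
open import Data.Fin using (Fin; zero; suc; inject₁)
open import Data.Vec using (Vec; []; _∷_; lookup; _∷ʳ_; initLast)
open import Data.Vec.Properties using (≡-dec; ∷ʳ-injectiveˡ; ∷ʳ-injectiveʳ; init-∷ʳ; last-∷ʳ)
open import Data.List using (map; length; filter; _++_) renaming ([] to []ˡ; _∷_ to _∷ˡ_)
open import Data.List.Properties using (map-++; map-∘; map-cong)
open import Data.Product using (∃-syntax; _×_; _,_)
open import Data.Empty using (⊥-elim)
open import Function using (_∘_)
open import Relation.Nullary using (yes; no; Dec)
open import Relation.Binary.PropositionalEquality
  using (_≡_; _≢_; refl; sym; trans; cong; cong₂; subst; subst₂; module ≡-Reasoning)
open import Relation.Binary.Construct.Closure.ReflexiveTransitive using (ε; _◅_; _◅◅_)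

_≟ⱽ_ : ∀ {d} (u v : Vertex d) → Dec (u ≡ v)
_≟ⱽ_ = ≡-dec _≟ᵇ_

adjacent⇒≢ : ∀ {d} {u v : Vertex d} → Adjacent u v → u ≢ v
adjacent⇒≢ (i , u≢v , _) u≡v = u≢v (cong (λ w → lookup w i) u≡v)

∷-adjacent : ∀ {d} {u v : Vertex d} x → Adjacent u v → Adjacent (x ∷ u) (x ∷ v)
∷-adjacent {u = u} {v} x (i , u≢v , agree) = suc i , u≢v , agree′
  where
  agree′ : ∀ j → j ≢ suc i → lookup (x ∷ u) j ≡ lookup (x ∷ v) j
  agree′ zero    _     = refl
  agree′ (suc j) j≢1+i = agree j (λ j≡i → j≢1+i (cong suc j≡i))

lookup-∷ʳ-inject₁ : ∀ {n} (u : Vec Bool n) b i → lookup (u ∷ʳ b) (inject₁ i) ≡ lookup u i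
lookup-∷ʳ-inject₁ (x ∷ u) b zero    = refl
lookup-∷ʳ-inject₁ (x ∷ u) b (suc i) = lookup-∷ʳ-inject₁ u b i

lookup-∷ʳ-agree : ∀ {n} (u v : Vec Bool n) b j →
  (∀ i → j ≡ inject₁ i → lookup u i ≡ lookup v i) → lookup (u ∷ʳ b) j ≡ lookup (v ∷ʳ b) j
lookup-∷ʳ-agree []      []      b zero    _     = refl
lookup-∷ʳ-agree (x ∷ u) (y ∷ v) b zero    agree = agree zero refl
lookup-∷ʳ-agree (x ∷ u) (y ∷ v) b (suc j) agree =
  lookup-∷ʳ-agree u v b j (λ i j≡i → agree (suc i) (cong suc j≡i))

∷ʳ-adjacent : ∀ {d} {u v : Vertex d} b → Adjacent u v → Adjacent (u ∷ʳ b) (v ∷ʳ b)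
∷ʳ-adjacent {u = u} {v} b (i , u≢v , agree) = inject₁ i , differ , agree′
  where
  differ : lookup (u ∷ʳ b) (inject₁ i) ≢ lookup (v ∷ʳ b) (inject₁ i)
  differ eq = u≢v (trans (sym (lookup-∷ʳ-inject₁ u b i)) (trans eq (lookup-∷ʳ-inject₁ v b i)))
  agree′ : ∀ j → j ≢ inject₁ i → lookup (u ∷ʳ b) j ≡ lookup (v ∷ʳ b) j
  agree′ j j≢i = lookup-∷ʳ-agree u v b j (λ k j≡k → agree k (λ k≡i → j≢i (trans j≡k (cong inject₁ k≡i))))

fibre-adjacent : ∀ {d} (v : Vertex d) {b c} → b ≢ c → Adjacent (v ∷ʳ b) (v ∷ʳ c)
fibre-adjacent []      b≢c = zero , b≢c , only-zero
  where
  only-zero : ∀ j → j ≢ zero → _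
  only-zero zero j≢0 = ⊥-elim (j≢0 refl)
fibre-adjacent (x ∷ v) b≢c = ∷-adjacent x (fibre-adjacent v b≢c)

b≢not-b : ∀ b → b ≢ not b
b≢not-b false ()
b≢not-b true  ()

afterMove : ∀ {d} → Dist d → Vertex d → Vertex d → Dist d
afterMove E u v x with x ≟ⱽ u
... | yes _ = E x ∸ 2
... | no  _ with x ≟ⱽ v
...   | yes _ = suc (E x)
...   | no  _ = E x

afterMove-source : ∀ {d} (E : Dist d) u v → afterMove E u v u ≡ E u ∸ 2
afterMove-source E u v with u ≟ⱽ u
... | yes _   = refl
... | no  u≢u = ⊥-elim (u≢u refl)

afterMove-target : ∀ {d} (E : Dist d) {u v} → u ≢ v → afterMove E u v v ≡ suc (E v)
afterMove-target E {u} {v} u≢v with v ≟ⱽ u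
... | yes v≡u = ⊥-elim (u≢v (sym v≡u))
... | no  _ with v ≟ⱽ v
...   | yes _   = refl
...   | no  v≢v = ⊥-elim (v≢v refl)

afterMove-other : ∀ {d} (E : Dist d) {u v} x → x ≢ u → x ≢ v → afterMove E u v x ≡ E x
afterMove-other E {u} {v} x x≢u x≢v with x ≟ⱽ u
... | yes x≡u = ⊥-elim (x≢u x≡u)
... | no  _ with x ≟ⱽ v
...   | yes x≡v = ⊥-elim (x≢v x≡v)
...   | no  _   = refl

move : ∀ {d} (E : Dist d) {u v} → Adjacent u v → 2 ≤ E u → Move E (afterMove E u v)
move E {u} {v} uv 2≤Eu =
  u , v , uv , 2≤Eu ,
  trans (cong (_+ 2) (afterMove-source E u v)) (m∸n+n≡m 2≤Eu) ,
  afterMove-target E (adjacent⇒≢ uv) ,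
  λ w w≢u w≢v → afterMove-other E w w≢u w≢v

drain : ∀ {d} (E : Dist d) {x y} → Adjacent y x →
  ∃[ E′ ] (Reach E E′ × E x + ⌊ E y /2⌋ ≤ E′ x × (∀ z → z ≢ x → z ≢ y → E′ z ≡ E z))
drain {d} E₀ {x} {y} yx = go (E₀ y) E₀ refl
  where
  Drained : Dist d → Set
  Drained E = ∃[ E′ ] (Reach E E′ × E x + ⌊ E y /2⌋ ≤ E′ x × (∀ z → z ≢ x → z ≢ y → E′ z ≡ E z))

  stay : ∀ E → ⌊ E y /2⌋ ≡ 0 → Drained E
  stay E half≡0 = E , ε , ≤-reflexive (trans (cong (E x +_) half≡0) (+-identityʳ (E x))) , λ _ _ _ → refl

  go : ∀ n E → E y ≡ n → Drained E
  go zero          E Ey≡0 = stay E (cong ⌊_/2⌋ Ey≡0)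
  go (suc zero)    E Ey≡1 = stay E (cong ⌊_/2⌋ Ey≡1)
  go (suc (suc n)) E Ey≡2+n with go n (afterMove E y x) (trans (afterMove-source E y x) (cong (_∸ 2) Ey≡2+n))
  ... | E′ , reach , bound , others =
    E′ , move E yx (subst (2 ≤_) (sym Ey≡2+n) (s≤s (s≤s z≤n))) ◅ reach , bound′ ,
    λ z z≢x z≢y → trans (others z z≢x z≢y) (afterMove-other E z z≢y z≢x)
    where
    E₁ = afterMove E y x
    open ≤-Reasoning
    bound′ : E x + ⌊ E y /2⌋ ≤ E′ x
    bound′ = begin
      E x + ⌊ E y /2⌋              ≡⟨ cong (λ k → E x + ⌊ k /2⌋) Ey≡2+n ⟩
      E x + suc ⌊ n /2⌋            ≡⟨ +-suc (E x) ⌊ n /2⌋ ⟩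
      suc (E x) + ⌊ n /2⌋          ≡⟨ cong₂ (λ p q → p + ⌊ q /2⌋) (sym (afterMove-target E (adjacent⇒≢ yx)))
                                         (sym (trans (afterMove-source E y x) (cong (_∸ 2) Ey≡2+n))) ⟩
      E₁ x + ⌊ E₁ y /2⌋            ≤⟨ bound ⟩
      E′ x                         ∎


Simulates : ∀ {d} → Dist (suc d) → Dist d → Bool → Bool → Set
Simulates E D b c = ∀ v → D v ≤ E (v ∷ʳ b) + ⌊ E (v ∷ʳ c) /2⌋

collect : ∀ {d} {D : Dist d} {E : Dist (suc d)} {b c} → b ≢ c → Simulates E D b c →
  ∀ v → ∃[ E′ ] (Reach E E′ × D v ≤ E′ (v ∷ʳ b) × (∀ z → z ≢ v ∷ʳ b → z ≢ v ∷ʳ c → E′ z ≡ E z))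
collect {E = E} b≢c sim v with drain E (fibre-adjacent v (λ c≡b → b≢c (sym c≡b)))
... | E′ , reach , bound , others = E′ , reach , ≤-trans (sim v) bound , others

simulate-move : ∀ {d} {D D′ : Dist d} {E : Dist (suc d)} {b c} → b ≢ c → Move D D′ →
  Simulates E D b c → ∃[ E′ ] (Reach E E′ × Simulates E′ D′ b c)
simulate-move {D = D} {D′} {E} {b} {c} b≢c (u , w , uw , 2≤Du , D′u+2≡Du , D′w≡1+Dw , D′-other) sim
  with collect b≢c sim u
... | E₁ , reach , Du≤E₁ub , E₁-other =
  E₂ , reach ◅◅ (move E₁ (∷ʳ-adjacent {u = u} {w} b uw) (≤-trans 2≤Du Du≤E₁ub) ◅ ε) , sim′
  where
  E₂ = afterMove E₁ (u ∷ʳ b) (w ∷ʳ b)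
  open ≤-Reasoning

  ∷ʳ≢ : ∀ {v x} {a e} → v ≢ x → v ∷ʳ a ≢ x ∷ʳ e
  ∷ʳ≢ {v} {x} v≢x eq = v≢x (∷ʳ-injectiveˡ v x eq)

  unchanged : ∀ z → z ≢ u ∷ʳ b → z ≢ u ∷ʳ c → z ≢ w ∷ʳ b → E₂ z ≡ E z
  unchanged z z≢ub z≢uc z≢wb = trans (afterMove-other E₁ z z≢ub z≢wb) (E₁-other z z≢ub z≢uc)

  sim′ : Simulates E₂ D′ b c
  sim′ v with v ≟ⱽ u
  ... | yes refl = begin
    D′ v                    ≤⟨ m+n≤o⇒m≤o∸n (D′ v) (subst (_≤ E₁ (v ∷ʳ b)) (sym D′u+2≡Du) Du≤E₁ub) ⟩
    E₁ (v ∷ʳ b) ∸ 2         ≡⟨ sym (afterMove-source E₁ (v ∷ʳ b) (w ∷ʳ b)) ⟩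
    E₂ (v ∷ʳ b)             ≤⟨ m≤m+n _ _ ⟩
    E₂ (v ∷ʳ b) + ⌊ E₂ (v ∷ʳ c) /2⌋ ∎
  ... | no v≢u with v ≟ⱽ w
  ...   | yes refl = begin
    D′ v                                          ≡⟨ D′w≡1+Dw ⟩
    suc (D v)                                     ≤⟨ s≤s (sim v) ⟩
    suc (E (v ∷ʳ b) + ⌊ E (v ∷ʳ c) /2⌋)           ≡⟨ cong₂ (λ p q → p + ⌊ q /2⌋)
                                                     (sym (trans (afterMove-target E₁ (∷ʳ≢ (adjacent⇒≢ uw)))
                                                                 (cong suc (E₁-other _ (∷ʳ≢ v≢u) (∷ʳ≢ v≢u)))))
                                                     (sym (unchanged _ (∷ʳ≢ v≢u) (∷ʳ≢ v≢u)
                                                                     (λ eq → b≢c (sym (∷ʳ-injectiveʳ v v eq))))) ⟩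
    E₂ (v ∷ʳ b) + ⌊ E₂ (v ∷ʳ c) /2⌋               ∎
  ...   | no v≢w = begin
    D′ v                                          ≡⟨ D′-other v v≢u v≢w ⟩
    D v                                           ≤⟨ sim v ⟩
    E (v ∷ʳ b) + ⌊ E (v ∷ʳ c) /2⌋                 ≡⟨ cong₂ (λ p q → p + ⌊ q /2⌋)
                                                     (sym (unchanged _ (∷ʳ≢ v≢u) (∷ʳ≢ v≢u) (∷ʳ≢ v≢w)))
                                                     (sym (unchanged _ (∷ʳ≢ v≢u) (∷ʳ≢ v≢u) (∷ʳ≢ v≢w))) ⟩
    E₂ (v ∷ʳ b) + ⌊ E₂ (v ∷ʳ c) /2⌋               ∎

simulate-reach : ∀ {d} {D D′ : Dist d} {E : Dist (suc d)} {b c} → b ≢ c → Reach D D′ →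
  Simulates E D b c → ∃[ E′ ] (Reach E E′ × Simulates E′ D′ b c)
simulate-reach b≢c ε         sim = _ , ε , sim
simulate-reach b≢c (m ◅ ms) sim with simulate-move b≢c m sim
... | E₁ , reach₁ , sim₁ with simulate-reach b≢c ms sim₁
...   | E₂ , reach₂ , sim₂ = E₂ , reach₁ ◅◅ reach₂ , sim₂

DK-delivers : ∀ r b → r ≤ DK r b + ⌊ DK r (not b) /2⌋
DK-delivers zero                b     = z≤n
DK-delivers (suc zero)          false = s≤s z≤n
DK-delivers (suc zero)          true  = s≤s z≤n
DK-delivers (suc (suc zero))    false = s≤s (s≤s z≤n)
DK-delivers (suc (suc zero))    true  = s≤s (s≤s z≤n)
DK-delivers (suc (suc (suc r))) b     =
  s≤s (s≤s (≤-trans (s≤s (DK-delivers r b)) (≤-reflexive (sym (+-suc (DK r b) _)))))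

lift-∷ʳ : ∀ {d} (D : Dist d) v b → lift D (v ∷ʳ b) ≡ DK (D v) b
lift-∷ʳ D v b = cong₂ (λ w c → DK (D w) c) (init-∷ʳ b v) (last-∷ʳ b v)

lift-simulates : ∀ {d} (D : Dist d) b → Simulates (lift D) D b (not b)
lift-simulates D b v =
  subst₂ (λ p q → D v ≤ p + ⌊ q /2⌋) (sym (lift-∷ʳ D v b)) (sym (lift-∷ʳ D v (not b)))
    (DK-delivers (D v) b)

lift-solvable : ∀ {d} t (D : Dist d) → Solvable t D → Solvable t (lift D)
lift-solvable t D solvable z with initLast z
... | v , b , refl with solvable v
...   | D′ , reach , t≤D′v with simulate-reach (b≢not-b b) reach (lift-simulates D b)
...     | E , reachE , sim with collect (b≢not-b b) sim v
...       | E′ , reachE′ , D′v≤E′vb , _ = E′ , reachE ◅◅ reachE′ , ≤-trans t≤D′v D′v≤E′vb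

occupied : ℕ → ℕ
occupied zero    = 0
occupied (suc _) = 1

occupied≤1 : ∀ n → occupied n ≤ 1
occupied≤1 zero    = z≤n
occupied≤1 (suc _) = s≤s z≤n

length-filter-occupied : ∀ {A : Set} (f : A → ℕ) xs →
  length (filter (λ x → 1 ≤? f x) xs) ≡ sum (map (occupied ∘ f) xs)
length-filter-occupied f []ˡ       = refl
length-filter-occupied f (x ∷ˡ xs) with f x
... | zero  = length-filter-occupied f xs
... | suc _ = cong suc (length-filter-occupied f xs)

sum-map-mono : ∀ {A : Set} {f g : A → ℕ} xs → (∀ x → f x ≤ g x) → sum (map f xs) ≤ sum (map g xs)
sum-map-mono []ˡ       f≤g = z≤n
sum-map-mono (x ∷ˡ xs) f≤g = +-mono-≤ (f≤g x) (sum-map-mono xs f≤g)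

sum-map-*ˡ : ∀ {A : Set} k (f : A → ℕ) xs → sum (map (λ x → k * f x) xs) ≡ k * sum (map f xs)
sum-map-*ˡ k f []ˡ       = sym (*-zeroʳ k)
sum-map-*ˡ k f (x ∷ˡ xs) = trans (cong (k * f x +_) (sum-map-*ˡ k f xs)) (sym (*-distribˡ-+ k (f x) _))

sum-map-+ : ∀ {A : Set} (f g : A → ℕ) xs → sum (map (λ x → f x + g x) xs) ≡ sum (map f xs) + sum (map g xs)
sum-map-+ f g []ˡ       = refl
sum-map-+ f g (x ∷ˡ xs) = trans (cong (f x + g x +_) (sum-map-+ f g xs)) (interchange (f x) (g x) _ _)
  where
  interchange : ∀ a b c e → a + b + (c + e) ≡ a + c + (b + e)
  interchange = solve-∀

sum-allVertices-∷ : ∀ d (g : Vertex (suc d) → ℕ) →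
  sum (map g (allVertices (suc d))) ≡
  sum (map (g ∘ (false ∷_)) (allVertices d)) + sum (map (g ∘ (true ∷_)) (allVertices d))
sum-allVertices-∷ d g = begin
  sum (map g (map (false ∷_) vs ++ map (true ∷_) vs))               ≡⟨ cong sum (map-++ g (map (false ∷_) vs) (map (true ∷_) vs)) ⟩
  sum (map g (map (false ∷_) vs) ++ map g (map (true ∷_) vs))       ≡⟨ sum-++ (map g (map (false ∷_) vs)) (map g (map (true ∷_) vs)) ⟩
  sum (map g (map (false ∷_) vs)) + sum (map g (map (true ∷_) vs))  ≡⟨ cong₂ _+_ (cong sum (sym (map-∘ vs)))
                                                                                     (cong sum (sym (map-∘ vs))) ⟩
  sum (map (g ∘ (false ∷_)) vs) + sum (map (g ∘ (true ∷_)) vs)      ∎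
  where
  open ≡-Reasoning
  vs = allVertices d

sum-allVertices-∷ʳ : ∀ d (g : Vertex (suc d) → ℕ) →
  sum (map g (allVertices (suc d))) ≡ sum (map (λ v → g (v ∷ʳ false) + g (v ∷ʳ true)) (allVertices d))
sum-allVertices-∷ʳ zero    g = sym (+-assoc (g (false ∷ [])) (g (true ∷ [])) 0)
sum-allVertices-∷ʳ (suc d) g = begin
  sum (map g (allVertices (suc (suc d))))
    ≡⟨ sum-allVertices-∷ (suc d) g ⟩
  sum (map (g ∘ (false ∷_)) (allVertices (suc d))) + sum (map (g ∘ (true ∷_)) (allVertices (suc d)))
    ≡⟨ cong₂ _+_ (sum-allVertices-∷ʳ d (g ∘ (false ∷_))) (sum-allVertices-∷ʳ d (g ∘ (true ∷_))) ⟩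
  sum (map (fibre ∘ (false ∷_)) (allVertices d)) + sum (map (fibre ∘ (true ∷_)) (allVertices d))
    ≡⟨ sym (sum-allVertices-∷ d fibre) ⟩
  sum (map fibre (allVertices (suc d)))  ∎
  where
  open ≡-Reasoning
  fibre : Vertex (suc d) → ℕ
  fibre v = g (v ∷ʳ false) + g (v ∷ʳ true)

sum-lift : ∀ {d} (g : ℕ → ℕ) (D : Dist d) →
  sum (map (g ∘ lift D) (allVertices (suc d))) ≡
  sum (map (λ v → g (DK (D v) false) + g (DK (D v) true)) (allVertices d))
sum-lift {d} g D = trans (sum-allVertices-∷ʳ d (g ∘ lift D))
  (cong sum (map-cong (λ v → cong₂ _+_ (cong g (lift-∷ʳ D v false)) (cong g (lift-∷ʳ D v true))) (allVertices d)))

suppSize≡sum-occupied : ∀ {d} (D : Dist d) → suppSize D ≡ sum (map (occupied ∘ D) (allVertices d))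
suppSize≡sum-occupied {d} D = length-filter-occupied D (allVertices d)

DK-size : ∀ r → 3 * (DK r false + DK r true) ≤ 4 * r + 2 * occupied r
DK-size zero                = z≤n
DK-size (suc zero)          = ≤ᵇ⇒≤ 6 6 tt
DK-size (suc (suc zero))    = ≤ᵇ⇒≤ 9 10 tt
DK-size (suc (suc (suc r))) = begin
  3 * ((2 + DK r false) + (2 + DK r true))  ≡⟨ unfold (DK r false) (DK r true) ⟩
  12 + 3 * (DK r false + DK r true)         ≤⟨ +-monoʳ-≤ 12 (DK-size r) ⟩
  12 + (4 * r + 2 * occupied r)             ≤⟨ +-monoʳ-≤ 12 (+-monoʳ-≤ (4 * r) (*-monoʳ-≤ 2 (occupied≤1 r))) ⟩
  12 + (4 * r + 2 * 1)                      ≡⟨ refold r ⟩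
  4 * (3 + r) + 2 * 1                       ∎
  where
  open ≤-Reasoning
  unfold : ∀ a c → 3 * ((2 + a) + (2 + c)) ≡ 12 + 3 * (a + c)
  unfold = solve-∀
  refold : ∀ r → 12 + (4 * r + 2 * 1) ≡ 4 * (3 + r) + 2 * 1
  refold = solve-∀

DK-support : ∀ r → occupied (DK r false) + occupied (DK r true) ≤ 2 * occupied r
DK-support zero    = z≤n
DK-support (suc r) = +-mono-≤ (occupied≤1 (DK (suc r) false)) (occupied≤1 (DK (suc r) true))

lift-size : ∀ {d} (D : Dist d) → 3 * size (lift D) ≤ 4 * size D + 2 * suppSize D
lift-size {d} D = begin
  3 * size (lift D)                                                  ≡⟨ cong (3 *_) (sum-lift (λ n → n) D) ⟩
  3 * sum (map (λ v → DK (D v) false + DK (D v) true) vs)           ≡⟨ sym (sum-map-*ˡ 3 _ vs) ⟩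
  sum (map (λ v → 3 * (DK (D v) false + DK (D v) true)) vs)         ≤⟨ sum-map-mono vs (DK-size ∘ D) ⟩
  sum (map (λ v → 4 * D v + 2 * occupied (D v)) vs)                 ≡⟨ sum-map-+ _ _ vs ⟩
  sum (map (λ v → 4 * D v) vs) + sum (map (λ v → 2 * occupied (D v)) vs)
                                                                     ≡⟨ cong₂ _+_ (sum-map-*ˡ 4 D vs) (sum-map-*ˡ 2 _ vs) ⟩
  4 * size D + 2 * sum (map (occupied ∘ D) vs)                      ≡⟨ cong (λ s → 4 * size D + 2 * s) (sym (suppSize≡sum-occupied D)) ⟩
  4 * size D + 2 * suppSize D                                        ∎
  where
  open ≤-Reasoning
  vs = allVertices d

lift-suppSize : ∀ {d} (D : Dist d) → suppSize (lift D) ≤ 2 * suppSize D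
lift-suppSize {d} D = begin
  suppSize (lift D)                                                  ≡⟨ suppSize≡sum-occupied (lift D) ⟩
  sum (map (occupied ∘ lift D) (allVertices (suc d)))                ≡⟨ sum-lift occupied D ⟩
  sum (map (λ v → occupied (DK (D v) false) + occupied (DK (D v) true)) vs)
                                                                     ≤⟨ sum-map-mono vs (DK-support ∘ D) ⟩
  sum (map (λ v → 2 * occupied (D v)) vs)                            ≡⟨ sum-map-*ˡ 2 _ vs ⟩
  2 * sum (map (occupied ∘ D) vs)                                    ≡⟨ cong (2 *_) (sym (suppSize≡sum-occupied D)) ⟩
  2 * suppSize D                                                     ∎
  where
  open ≤-Reasoning
  vs = allVertices d

theorem6p4 : (d t : ℕ) → 1 ≤ d → 1 ≤ t → (D : Dist d) → Solvable t D →
    Solvable t (lift D) × (3 * size (lift D) ≤ 4 * size D + 2 * suppSize D)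
      × suppSize (lift D) ≤ 2 * suppSize D
theorem6p4 d t _ _ D solvable = lift-solvable t D solvable , lift-size D , lift-suppSize D
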